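{- There is a constant $c$ such that for every $n\ge1$ there is a boolean CPS refutation over $\mathbb{Z}$ of the binary value principle $\mathrm{BVP}_n$ (the equation $\sum_{i=1}^n2^{i-1}x_i+1=0$) of size at most $cn$.
   Context: Circuit size is the number of nodes, each ring constant counting as one node. Let $R$ be an ordered ring. A squaring gate is a product gate both of whose inputs come from the same node. An algebraic circuit $C$ over $R$ in variables $\bar x,\bar y$ is $\bar y$-conic if for every leaf labelled by a negative constant or by an $x$-variable, every directed path from that leaf to the output passes through a squaring gate. Boolean CPS: given equations $\{f_i(\bar x)=0\}$ and inequalities, one forms the list $\mathcal H=(h_1,\dots,h_\ell)$ of inequalities $h_k\ge0$ which contains the given inequalities, $x_i\ge0$ and $1-x_i\ge0$ for every variable, and both $f\ge0$ and $-f\ge0$ for every given equation $f=0$ as well as for every $x_i^2-x_i=0$. A CPS proof of $p$ is a $\bar y$-conic circuit $C(\bar x,y_1,\dots,y_\ell)$ with $C(\bar x,h_1,\dots,h_\ell)=p$ as a formal polynomial identity; its size is the size of $C$; a refutation is a proof of $p=-1$. -}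

module Defs where

open import Data.Nat using (ℕ; zero; suc; _^_)
open import Data.Integer using (ℤ; +_; _<_; -_) renaming (_+_ to _+ℤ_; _*_ to _*ℤ_; 0ℤ to 0ℤ; 1ℤ to 1ℤ)
open import Data.Fin using (Fin; zero; suc; toℕ)
open import Data.List using (List; []; _∷_; foldr)
open import Data.List.Relation.Unary.Any using (Any)
open import Data.Vec.Functional using () 
open import Data.Empty using (⊥)
open import Data.Unit using (⊤)
open import Data.Sum using (_⊎_)
open import Relation.Binary.PropositionalEquality using (_≡_)
open import Data.List using (allFin)

-- Formal polynomials over ℤ in variables Fin n:
-- polynomial expressions modulo the congruence generated by the
-- commutative-ring axioms and the arithmetic of ℤ on constants.
-- (This is the presentation of ℤ[x₁,…,xₙ] as the free commutative
-- ℤ-algebra; _≈ₚ_ is formal polynomial identity.)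

infixl 6 _⊕_
infixl 7 _⊗_
infix 4 _≈ₚ_

data Expr (n : ℕ) : Set where
  var : Fin n → Expr n
  con : ℤ → Expr n
  _⊕_ : Expr n → Expr n → Expr n
  _⊗_ : Expr n → Expr n → Expr n
  ⊖_  : Expr n → Expr n

data _≈ₚ_ {n : ℕ} : Expr n → Expr n → Set where
  refl≈  : ∀ {p} → p ≈ₚ p
  sym≈   : ∀ {p q} → p ≈ₚ q → q ≈ₚ p
  trans≈ : ∀ {p q r} → p ≈ₚ q → q ≈ₚ r → p ≈ₚ r
  ⊕-cong : ∀ {p p′ q q′} → p ≈ₚ p′ → q ≈ₚ q′ → p ⊕ q ≈ₚ p′ ⊕ q′
  ⊗-cong : ∀ {p p′ q q′} → p ≈ₚ p′ → q ≈ₚ q′ → p ⊗ q ≈ₚ p′ ⊗ q′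
  ⊖-cong : ∀ {p p′} → p ≈ₚ p′ → ⊖ p ≈ₚ ⊖ p′
  ⊕-assoc : ∀ p q r → (p ⊕ q) ⊕ r ≈ₚ p ⊕ (q ⊕ r)
  ⊕-comm  : ∀ p q → p ⊕ q ≈ₚ q ⊕ p
  ⊕-idˡ   : ∀ p → con 0ℤ ⊕ p ≈ₚ p
  ⊖-invˡ  : ∀ p → (⊖ p) ⊕ p ≈ₚ con 0ℤ
  ⊗-assoc : ∀ p q r → (p ⊗ q) ⊗ r ≈ₚ p ⊗ (q ⊗ r)
  ⊗-comm  : ∀ p q → p ⊗ q ≈ₚ q ⊗ p
  ⊗-idˡ   : ∀ p → con 1ℤ ⊗ p ≈ₚ p
  distribˡ : ∀ p q r → p ⊗ (q ⊕ r) ≈ₚ (p ⊗ q) ⊕ (p ⊗ r)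
  con-+ : ∀ a b → con a ⊕ con b ≈ₚ con (a +ℤ b)
  con-* : ∀ a b → con a ⊗ con b ≈ₚ con (a *ℤ b)
  con-- : ∀ a → ⊖ con a ≈ₚ con (- a)

-- A circuit of size s is a list of s nodes; node indices are counted
-- from the most recently added node (index zero), and every gate refers
-- only to earlier nodes.  The output is the node with index zero.

data Node (n : ℕ) (Y : Set) (s : ℕ) : Set where
  xvar : Fin n → Node n Y s
  yvar : Y → Node n Y s
  const : ℤ → Node n Y s
  add  : Fin s → Fin s → Node n Y s
  mul  : Fin s → Fin s → Node n Y s

infixl 5 _▷_
data Circuit (n : ℕ) (Y : Set) : ℕ → Set where
  []  : Circuit n Y zero
  _▷_ : ∀ {s} → Circuit n Y s → Node n Y s → Circuit n Y (suc s)

ChildOf : ∀ {n Y s} → Fin s → Node n Y s → Set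
ChildOf c (add i j) = c ≡ i ⊎ c ≡ j
ChildOf c (mul i j) = c ≡ i ⊎ c ≡ j
ChildOf c _ = ⊥

Edge : ∀ {n Y s} → Circuit n Y s → Fin s → Fin s → Set
Edge []      ()      _
Edge (C ▷ g) zero    _       = ⊥
Edge (C ▷ g) (suc a) zero    = ChildOf a g
Edge (C ▷ g) (suc a) (suc b) = Edge C a b

SquaringNode : ∀ {n Y s} → Node n Y s → Set
SquaringNode (mul i j) = i ≡ j
SquaringNode _ = ⊥

IsSquaring : ∀ {n Y s} → Circuit n Y s → Fin s → Set
IsSquaring []      ()
IsSquaring (C ▷ g) zero    = SquaringNode g
IsSquaring (C ▷ g) (suc k) = IsSquaring C k

BadLeafNode : ∀ {n Y s} → Node n Y s → Set
BadLeafNode (xvar _)  = ⊤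
BadLeafNode (const c) = c < 0ℤ
BadLeafNode _ = ⊥

IsBadLeaf : ∀ {n Y s} → Circuit n Y s → Fin s → Set
IsBadLeaf []      ()
IsBadLeaf (C ▷ g) zero    = BadLeafNode g
IsBadLeaf (C ▷ g) (suc k) = IsBadLeaf C k

data Path {n Y s} (C : Circuit n Y s) : Fin s → Fin s → Set where
  here : ∀ a → Path C a a
  step : ∀ {a b c} → Edge C a b → Path C b c → Path C a c

pathNodes : ∀ {n Y s} {C : Circuit n Y s} {a b} → Path C a b → List (Fin s)
pathNodes (here a) = a ∷ []
pathNodes (step {a = a} _ p) = a ∷ pathNodes p

Conic : ∀ {n Y s} → Circuit n Y (suc s) → Set
Conic {s = s} C = ∀ (a : Fin (suc s)) → IsBadLeaf C a →
  (p : Path C a zero) → Any (IsSquaring C) (pathNodes p)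

nodeVal : ∀ {n Y s} → (Y → Expr n) → (Fin s → Expr n) → Node n Y s → Expr n
nodeVal h v (xvar i)  = var i
nodeVal h v (yvar k)  = h k
nodeVal h v (const c) = con c
nodeVal h v (add i j) = v i ⊕ v j
nodeVal h v (mul i j) = v i ⊗ v j

values : ∀ {n Y s} → (Y → Expr n) → Circuit n Y s → Fin s → Expr n
values h []      ()
values h (C ▷ g) zero    = nodeVal h (values h C) g
values h (C ▷ g) (suc k) = values h C k

evalCircuit : ∀ {n Y s} → (Y → Expr n) → Circuit n Y (suc s) → Expr n
evalCircuit h C = values h C zero

-- The binary value principle BVP_n : Σ_{i=1}^n 2^{i-1} x_i + 1 = 0
-- (variables indexed 0 … n-1, so coefficient of x_i is 2^i)

bvp : (n : ℕ) → Expr n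
bvp n = foldr (λ i acc → con (+ (2 ^ toℕ i)) ⊗ var i ⊕ acc) (con 1ℤ) (allFin n)

-- Boolean CPS list H for the single equation f = 0 (no inequalities):
-- x_i ≥ 0, 1 - x_i ≥ 0, f ≥ 0, -f ≥ 0, x_i²-x_i ≥ 0, -(x_i²-x_i) ≥ 0.
-- The y-variables are indexed by this type (ℓ = 4n + 2).
data HIdx (n : ℕ) : Set where
  nonneg    : Fin n → HIdx n
  upper     : Fin n → HIdx n
  eqPos     : HIdx n
  eqNeg     : HIdx n
  boolPos   : Fin n → HIdx n
  boolNeg   : Fin n → HIdx n

booleanH : ∀ {n} → Expr n → HIdx n → Expr n
booleanH f (nonneg i)  = var i
booleanH f (upper i)   = con 1ℤ ⊕ ⊖ var i
booleanH f eqPos       = f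
booleanH f eqNeg       = ⊖ f
booleanH f (boolPos i) = var i ⊗ var i ⊕ ⊖ var i
booleanH f (boolNeg i) = ⊖ (var i ⊗ var i ⊕ ⊖ var i)

record CPSRefutation {n : ℕ} (f : Expr n) (m : ℕ) : Set where
  -- the circuit has size suc m (it has at least the output node)
  field
    circuit : Circuit n (HIdx n) (suc m)
    conic   : Conic circuit
    refutes : evalCircuit (booleanH f) circuit ≈ₚ con (- 1ℤ)

-- Over ℤ the hypotheses xᵢ ≥ 0 and −f ≥ 0 already refute f = Σ wᵢ xᵢ + 1 with all wᵢ ≥ 0:
-- the nonnegative combination Σ wᵢ·xᵢ + (−f) equals −1 identically. As a circuit in the
-- y-variables it needs four nodes per variable, and it has neither x-leaves nor negative
-- constants, so it is conic without using a single squaring gate.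
module Submission where

open import Defs
open import Data.Nat using (ℕ; suc; _*_; _≤_; _^_)
open import Data.Product using (∃; ∃-syntax; _×_; _,_)
open import Data.Nat.Properties using (*-comm; +-monoʳ-≤; *-monoʳ-≤; n≤1+n)
open import Data.Integer using (+_; -_; +<+; 0ℤ; 1ℤ)
open import Data.Fin using (Fin; zero; suc; toℕ)
open import Data.List using (List; []; _∷_; foldr; allFin; length)
open import Data.List.Properties using (length-tabulate)
open import Data.Empty using (⊥-elim)
open import Relation.Nullary using (¬_)
open import Relation.Binary.Bundles using (Setoid)
open import Relation.Binary.PropositionalEquality using (_≡_; refl; cong; subst; sym)
import Relation.Binary.Reasoning.Setoid as SetoidReasoning
open import Function using (id)
open import Level using (0ℓ)

≈ₚ-setoid : ℕ → Setoid 0ℓ 0ℓ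
≈ₚ-setoid n = record
  { Carrier = Expr n
  ; _≈_ = _≈ₚ_
  ; isEquivalence = record { refl = refl≈ ; sym = sym≈ ; trans = trans≈ }
  }

linearForm : ∀ {n} → (Fin n → ℕ) → List (Fin n) → Expr n → Expr n
linearForm w L e = foldr (λ i acc → con (+ w i) ⊗ var i ⊕ acc) e L

module _ {n : ℕ} where
  open SetoidReasoning (≈ₚ-setoid n)

  ⊕-idʳ : ∀ (p : Expr n) → p ⊕ con 0ℤ ≈ₚ p
  ⊕-idʳ p = trans≈ (⊕-comm p _) (⊕-idˡ p)

  linearForm-split : ∀ w L (e : Expr n) →
    linearForm w L e ≈ₚ linearForm w L (con 0ℤ) ⊕ e
  linearForm-split w []      e = sym≈ (⊕-idˡ e)
  linearForm-split w (i ∷ L) e =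
    trans≈ (⊕-cong refl≈ (linearForm-split w L e)) (sym≈ (⊕-assoc _ _ _))

  ⊕-⊖-suc-cancel : ∀ (p : Expr n) → p ⊕ ⊖ (p ⊕ con 1ℤ) ≈ₚ con (- 1ℤ)
  ⊕-⊖-suc-cancel p = begin
    q                                 ≈⟨ ⊕-idʳ q ⟨
    q ⊕ con 0ℤ                        ≈⟨ ⊕-cong refl≈ (con-+ 1ℤ (- 1ℤ)) ⟨
    q ⊕ (con 1ℤ ⊕ con (- 1ℤ))         ≈⟨ ⊕-assoc q _ _ ⟨
    (q ⊕ con 1ℤ) ⊕ con (- 1ℤ)         ≈⟨ ⊕-cong (⊕-cong (⊕-comm p _) refl≈) refl≈ ⟩
    (⊖ (p ⊕ con 1ℤ) ⊕ p ⊕ con 1ℤ) ⊕ con (- 1ℤ)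
                                      ≈⟨ ⊕-cong (⊕-assoc _ p _) refl≈ ⟩
    ⊖ (p ⊕ con 1ℤ) ⊕ (p ⊕ con 1ℤ) ⊕ con (- 1ℤ)
                                      ≈⟨ ⊕-cong (⊖-invˡ _) refl≈ ⟩
    con 0ℤ ⊕ con (- 1ℤ)               ≈⟨ ⊕-idˡ _ ⟩
    con (- 1ℤ)                        ∎
    where q = p ⊕ ⊖ (p ⊕ con 1ℤ)

module _ {n : ℕ} (w : Fin n → ℕ) where

  nonnegCombination : (L : List (Fin n)) → Circuit n (HIdx n) (suc (length L * 4))
  nonnegCombination []      = [] ▷ yvar eqNeg
  nonnegCombination (i ∷ L) =
    nonnegCombination L ▷ const (+ w i) ▷ yvar (nonneg i)
      ▷ mul (suc zero) zero
      -- node 3 below the product is the output of nonnegCombination L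
      ▷ add zero (suc (suc (suc zero)))

  nonnegCombination-noBadLeaf : ∀ L a → ¬ IsBadLeaf (nonnegCombination L) a
  nonnegCombination-noBadLeaf []      zero                      ()
  nonnegCombination-noBadLeaf (i ∷ L) zero                      ()
  nonnegCombination-noBadLeaf (i ∷ L) (suc zero)                ()
  nonnegCombination-noBadLeaf (i ∷ L) (suc (suc zero))          ()
  nonnegCombination-noBadLeaf (i ∷ L) (suc (suc (suc zero)))    (+<+ ())
  nonnegCombination-noBadLeaf (i ∷ L) (suc (suc (suc (suc a)))) = nonnegCombination-noBadLeaf L a

  nonnegCombination-conic : ∀ L → Conic (nonnegCombination L)
  nonnegCombination-conic L a bad _ = ⊥-elim (nonnegCombination-noBadLeaf L a bad)

  nonnegCombination-value : ∀ f L →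
    evalCircuit (booleanH f) (nonnegCombination L) ≡ linearForm w L (⊖ f)
  nonnegCombination-value f []      = refl
  nonnegCombination-value f (i ∷ L) =
    cong (λ acc → con (+ w i) ⊗ var i ⊕ acc) (nonnegCombination-value f L)

  linearForm-refutation : ∀ L → CPSRefutation (linearForm w L (con 1ℤ)) (length L * 4)
  linearForm-refutation L = record
    { circuit = nonnegCombination L
    ; conic   = nonnegCombination-conic L
    ; refutes = subst (_≈ₚ con (- 1ℤ)) (sym (nonnegCombination-value f L)) (begin
        linearForm w L (⊖ f)       ≈⟨ linearForm-split w L (⊖ f) ⟩
        Σ ⊕ ⊖ f                    ≈⟨ ⊕-cong refl≈ (⊖-cong (linearForm-split w L (con 1ℤ))) ⟩
        Σ ⊕ ⊖ (Σ ⊕ con 1ℤ)         ≈⟨ ⊕-⊖-suc-cancel Σ ⟩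
        con (- 1ℤ)                 ∎)
    }
    where
    open SetoidReasoning (≈ₚ-setoid n)
    f = linearForm w L (con 1ℤ)
    Σ = linearForm w L (con 0ℤ)

1+n*4≤5*n : ∀ n → 1 ≤ n → suc (n * 4) ≤ 5 * n
1+n*4≤5*n (suc k) _ =
  subst (suc (suc k * 4) ≤_) (*-comm (suc k) 5) (+-monoʳ-≤ 5 (*-monoʳ-≤ k (n≤1+n 4)))

proposition4p4 : ∃[ c ] ∀ (n : ℕ) → 1 ≤ n →
    ∃[ m ] (CPSRefutation (bvp n) m × suc m ≤ c * n)
proposition4p4 = 5 , λ n 1≤n →
  length (allFin n) * 4 ,
  linearForm-refutation (λ i → 2 ^ toℕ i) (allFin n) ,
  subst (λ k → suc (k * 4) ≤ 5 * n) (sym (length-tabulate {n = n} id))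
    (1+n*4≤5*n n 1≤n)
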